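{- Let $(a_0,a_1,\dots)$ be a sequence of nonnegative integers. Then $(x_k)_{k\ge 0}$ is a strictly increasing sequence of positive real numbers.
   Context: Define vectors in $\mathbb{R}^3$ by $C_{ -3}=(1,0,0)$, $C_{ -2}=(0,1,0)$, $C_{ -1}=(0,0,1)$, $C_k=C_{k-3}-C_{k-2}-a_kC_{k-1}$ for $k\ge0$, and $X_k=C_k\times C_{k+1}$ (cross product) for $k\ge-3$; write $X_k=(x_k,y_k,z_k)$. -}

module Defs where

open import Data.Nat using (ℕ; zero; suc)
open import Data.Integer using (ℤ; +_; _+_; _-_; _*_)

-- Vectors in ℤ³ (all C_k have integer entries since the a_k are integers).
record V3 : Set where
  constructor ⟨_,_,_⟩
  field
    v₁ v₂ v₃ : ℤ
open V3 public

_⊖_ : V3 → V3 → V3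
⟨ a , b , c ⟩ ⊖ ⟨ d , e , f ⟩ = ⟨ a - d , b - e , c - f ⟩

_·_ : ℤ → V3 → V3
t · ⟨ a , b , c ⟩ = ⟨ t * a , t * b , t * c ⟩

_×₃_ : V3 → V3 → V3
⟨ a , b , c ⟩ ×₃ ⟨ d , e , f ⟩ = ⟨ b * f - c * e , c * d - a * f , a * e - b * d ⟩

-- Shifted indexing: Cs a n = C_{n-3}.
-- Cs a 0 = C_{-3}, Cs a 1 = C_{-2}, Cs a 2 = C_{-1},
-- Cs a (n+3) = C_n = C_{n-3} - C_{n-2} - a_n C_{n-1}.
Cs : (ℕ → ℕ) → ℕ → V3
Cs a zero = ⟨ + 1 , + 0 , + 0 ⟩
Cs a (suc zero) = ⟨ + 0 , + 1 , + 0 ⟩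
Cs a (suc (suc zero)) = ⟨ + 0 , + 0 , + 1 ⟩
Cs a (suc (suc (suc n))) =
  (Cs a n ⊖ Cs a (suc n)) ⊖ ((+ a n) · Cs a (suc (suc n)))

C : (ℕ → ℕ) → ℕ → V3
C a k = Cs a (3 Data.Nat.+ k)

X : (ℕ → ℕ) → ℕ → V3
X a k = C a k ×₃ C a (suc k)

x : (ℕ → ℕ) → ℕ → ℤ
x a k = v₁ (X a k)

-- The vectors X_n obey X_n = X_{n-1} + a_n X_{n-2} + X_{n-3}: expand
-- X_n = C_n × C_{n+1} using C_n = C_{n-3} - C_{n-2} - a_n C_{n-1} and
-- C_{n+1} = C_{n-2} - C_{n-1} - a_{n+1} C_n; the coefficient a_{n+1} disappears since C_n × C_n = 0.
-- Hence x_n = x_{n-1} + a_n x_{n-2} + x_{n-3} with x_{-3} = 0 and x_{-2} = x_{-1} = 1, and a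
-- recurrence with nonnegative coefficients and such initial values is positive from index -2 on
-- and strictly increasing from index 0 on.
module Submission where

open import Defs
open import Data.Nat using (ℕ; suc)
open import Data.Integer using (ℤ; +_; _<_)
open import Data.Product using (_×_)

import Data.Nat as N
open import Data.Integer using (_≤_; _+_; _-_; _*_; +≤+; +<+)
open import Data.Integer.Properties
  using (<⇒≤; <-≤-trans; +-monoʳ-≤; +-mono-≤; +-mono-≤-<; +-identityʳ; *-zeroʳ; *-monoˡ-≤-nonNeg)
open import Data.Integer.Tactic.RingSolver using (solve-∀)
open import Relation.Binary.PropositionalEquality using (_≡_; refl; cong; trans; subst; sym)
open import Data.Product using (_,_)

_⊕_ : V3 → V3 → V3
⟨ a , b , c ⟩ ⊕ ⟨ d , e , f ⟩ = ⟨ a + d , b + e , c + f ⟩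

⟨⟩-cong : ∀ {x₁ x₂ x₃ y₁ y₂ y₃ : ℤ} →
  x₁ ≡ y₁ → x₂ ≡ y₂ → x₃ ≡ y₃ → ⟨ x₁ , x₂ , x₃ ⟩ ≡ ⟨ y₁ , y₂ , y₃ ⟩
⟨⟩-cong refl refl refl = refl

×₃-recurrence : ∀ (P Q R : V3) (b c : ℤ) → let S = (P ⊖ Q) ⊖ (b · R) in
  S ×₃ ((Q ⊖ R) ⊖ (c · S)) ≡ ((R ×₃ S) ⊕ (b · (Q ×₃ R))) ⊕ (P ×₃ Q)
×₃-recurrence ⟨ p₁ , p₂ , p₃ ⟩ ⟨ q₁ , q₂ , q₃ ⟩ ⟨ r₁ , r₂ , r₃ ⟩ b c =
  ⟨⟩-cong (coordinate p₂ p₃ q₂ q₃ r₂ r₃ b c) (coordinate p₃ p₁ q₃ q₁ r₃ r₁ b c)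
          (coordinate p₁ p₂ q₁ q₂ r₁ r₂ b c)
  where
  coordinate : ∀ pᵢ pⱼ qᵢ qⱼ rᵢ rⱼ b c →
    ((pᵢ - qᵢ) - b * rᵢ) * ((qⱼ - rⱼ) - c * ((pⱼ - qⱼ) - b * rⱼ))
      - ((pⱼ - qⱼ) - b * rⱼ) * ((qᵢ - rᵢ) - c * ((pᵢ - qᵢ) - b * rᵢ))
    ≡ ((rᵢ * ((pⱼ - qⱼ) - b * rⱼ) - rⱼ * ((pᵢ - qᵢ) - b * rᵢ)) + b * (qᵢ * rⱼ - qⱼ * rᵢ))
      + (pᵢ * qⱼ - pⱼ * qᵢ)
  coordinate = solve-∀

+0≤+*+0≤ : ∀ m {j} → + 0 ≤ j → + 0 ≤ + m * j
+0≤+*+0≤ m {j} 0≤j = subst (_≤ + m * j) (*-zeroʳ (+ m)) (*-monoˡ-≤-nonNeg (+ m) 0≤j)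

i+0+0≡i : ∀ i → (i + + 0) + + 0 ≡ i
i+0+0≡i i = trans (+-identityʳ (i + + 0)) (+-identityʳ i)

i≤i+j+k : ∀ i {j k} → + 0 ≤ j → + 0 ≤ k → i ≤ (i + j) + k
i≤i+j+k i {j} {k} 0≤j 0≤k = subst (_≤ (i + j) + k) (i+0+0≡i i) (+-mono-≤ (+-monoʳ-≤ i 0≤j) 0≤k)

i<i+j+k : ∀ i {j k} → + 0 ≤ j → + 0 < k → i < (i + j) + k
i<i+j+k i {j} {k} 0≤j 0<k = subst (_< (i + j) + k) (i+0+0≡i i) (+-mono-≤-< (+-monoʳ-≤ i 0≤j) 0<k)

module NonNegativeRecurrence (u : ℕ → ℤ) (b : ℕ → ℕ)
  (recurrence : ∀ n → u (3 N.+ n) ≡ (u (2 N.+ n) + + b n * u (1 N.+ n)) + u n) where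

  recurrence-≤ : ∀ n → + 0 ≤ u (1 N.+ n) → + 0 ≤ u n → u (2 N.+ n) ≤ u (3 N.+ n)
  recurrence-≤ n 0≤u₁ 0≤u₀ =
    subst (_ ≤_) (sym (recurrence n)) (i≤i+j+k (u (2 N.+ n)) (+0≤+*+0≤ (b n) 0≤u₁) 0≤u₀)

  recurrence-< : ∀ n → + 0 ≤ u (1 N.+ n) → + 0 < u n → u (2 N.+ n) < u (3 N.+ n)
  recurrence-< n 0≤u₁ 0<u₀ =
    subst (_ <_) (sym (recurrence n)) (i<i+j+k (u (2 N.+ n)) (+0≤+*+0≤ (b n) 0≤u₁) 0<u₀)

  module FromInitialValues (0≤u₀ : + 0 ≤ u 0) (0<u₁ : + 0 < u 1) (0<u₂ : + 0 < u 2) where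

    0<u[1+n] : ∀ n → + 0 < u (suc n)
    0≤u : ∀ n → + 0 ≤ u n

    0<u[1+n] 0             = 0<u₁
    0<u[1+n] 1             = 0<u₂
    0<u[1+n] (suc (suc n)) =
      <-≤-trans (0<u[1+n] (suc n)) (recurrence-≤ n (<⇒≤ (0<u[1+n] n)) (0≤u n))

    0≤u 0       = 0≤u₀
    0≤u (suc n) = <⇒≤ (0<u[1+n] n)

    u[3+n]<u[4+n] : ∀ n → u (3 N.+ n) < u (4 N.+ n)
    u[3+n]<u[4+n] n = recurrence-< (suc n) (0≤u (2 N.+ n)) (0<u[1+n] n)

-- Xs a n = X_{n-3}, in the shifted indexing of Cs.
Xs : (ℕ → ℕ) → ℕ → V3
Xs a n = Cs a n ×₃ Cs a (suc n)

Xs-recurrence : ∀ a n → Xs a (3 N.+ n) ≡ ((Xs a (2 N.+ n) ⊕ ((+ a n) · Xs a (1 N.+ n))) ⊕ Xs a n)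
Xs-recurrence a n =
  ×₃-recurrence (Cs a n) (Cs a (suc n)) (Cs a (suc (suc n))) (+ a n) (+ a (suc n))

x₋₁≡1 : ∀ a → v₁ (Xs a 2) ≡ + 1
x₋₁≡1 a = e₃×C₀ (+ a 0)
  where
  e₃×C₀ : ∀ t → + 0 * ((+ 0 - + 0) - t * + 1) - + 1 * ((+ 0 - + 1) - t * + 0) ≡ + 1
  e₃×C₀ = solve-∀

corollary2 : (a : ℕ → ℕ) → (k : ℕ) → (+ 0 < x a k) × (x a k < x a (suc k))
corollary2 a k = 0<u[1+n] (2 N.+ k) , u[3+n]<u[4+n] k
  where
  open NonNegativeRecurrence (λ n → v₁ (Xs a n)) a (λ n → cong v₁ (Xs-recurrence a n))
  0<1 : + 0 < + 1
  0<1 = +<+ (N.s≤s N.z≤n)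
  open FromInitialValues (+≤+ N.z≤n) 0<1 (subst (+ 0 <_) (sym (x₋₁≡1 a)) 0<1)
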